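{- Let $q=2^m$, where $m$ is a positive integer, and let $a,b\in\mathbb{F}_q^*$. Then the polynomial $$f_1(X)=X^{2q^2}+aX^{q^2+q-1}+bX^{q^2-q+1}$$ is a permutation polynomial over $\mathbb{F}_{q^3}$ if and only if $b=a$.
   Context: A polynomial $f\in\mathbb{F}_{Q}[X]$ is a permutation polynomial over $\mathbb{F}_Q$ if the map $c\mapsto f(c)$ is a bijection of $\mathbb{F}_Q$. $\mathbb{F}_q^*$ denotes the set of nonzero elements of $\mathbb{F}_q$, and $\mathbb{F}_q\subseteq\mathbb{F}_{q^3}$. -}

module Defs where

open import Level using (0ℓ)
open import Algebra.Bundles using (CommutativeRing)
open import Data.Nat using (ℕ; zero; suc)
open import Data.Fin using (Fin)
open import Data.Product using (Σ; ∃; _×_)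
open import Relation.Nullary using (¬_)
open import Function.Bundles using (Inverse)
import Relation.Binary.PropositionalEquality as P

module _ (R : CommutativeRing 0ℓ 0ℓ) where
  open CommutativeRing R

  pow : Carrier → ℕ → Carrier
  pow x zero    = 1#
  pow x (suc n) = x * pow x n

  IsField : Set
  IsField = (¬ (1# ≈ 0#)) × (∀ x → ¬ (x ≈ 0#) → ∃ λ y → x * y ≈ 1#)

  HasCard : ℕ → Set
  HasCard n = Inverse setoid (P.setoid (Fin n))

  InSubfield : ℕ → Carrier → Set
  InSubfield q x = pow x q ≈ x

  IsPermutation : (Carrier → Carrier) → Set
  IsPermutation f = (∀ x y → f x ≈ f y → x ≈ y) × (∀ y → ∃ λ x → f x ≈ y)

module Submission where

-- φ x = x ^ q generates Gal(𝔽_q³ / 𝔽_q). With x₁ = φ x, x₂ = φ x₁ and Tr, E₂, Nm the elementary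
-- symmetric functions of x, x₁, x₂, the three exponents of f give Nm x · f x = x₂² (Nm x + a x₁² + b x²).
-- If b ≠ a, then a + b ∈ 𝔽_q* is a root of f besides 0.
-- If b = a, then Nm x · f x = a y² + c y with y = x₂² and c = Nm x + a (Tr x)² ∈ 𝔽_q, and the
-- conjugates of f x come from the conjugates of y. The symmetric functions of f x determine Tr x and,
-- unless f x ∈ 𝔽_q (where f x = x²), also c and hence Nm x; then a y² + c y = a y′² + c y′ together
-- with Tr x = Tr x′ forces y = y′. An injective map of a finite field to itself is bijective.

open import Defs

open import Level using (0ℓ)
open import Algebra.Bundles using (CommutativeRing; RawRing)
open import Algebra.Solver.Ring.AlmostCommutativeRing
  using (_-Raw-AlmostCommutative⟶_; fromCommutativeRing; Induced-equivalence)
open import Data.Bool.Base using (Bool; true; false; _xor_; _∧_; if_then_else_)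
open import Data.Empty using (⊥-elim)
open import Data.Fin.Base as Fin using (Fin; punchIn; punchOut)
open import Data.Fin.Permutation using (Permutation; permutation; _⟨$⟩ʳ_)
open import Data.Fin.Properties using (any?; inj⇒≟; injective⇒≤; punchOut-injective; punchInᵢ≢i)
  renaming (_≟_ to _≟ᶠ_)
open import Data.Maybe.Base using (just; nothing)
import Data.Nat.Base as ℕ
import Data.Nat.Properties as ℕ
open import Data.Product.Base using (∃; _,_; proj₁; proj₂)
open import Data.Sum.Base using (_⊎_; inj₁; inj₂; [_,_]′; map₂)
open import Function.Base using (_∘_; id)
open import Function.Bundles using (Inverse; _⇔_; mk⇔)
open import Function.Definitions using (Injective)
open import Function.Properties.Inverse using (Inverse⇒Injection)
open import Relation.Binary.Bundles using (Setoid)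
open import Relation.Binary.Definitions using (Decidable; WeaklyDecidable)
open import Relation.Binary.PropositionalEquality as ≡ using (_≡_; _≢_)
open import Relation.Nullary using (¬_; yes; no)

2ᵐ-cubed-even : ∀ m → 1 ℕ.≤ m → ∃ λ k → (2 ℕ.^ m) ℕ.^ 3 ≡ 2 ℕ.* k
2ᵐ-cubed-even (ℕ.suc m) _ = 2 ℕ.^ m ℕ.* (2 ℕ.^ ℕ.suc m) ℕ.^ 2 , ℕ.*-assoc 2 (2 ℕ.^ m) _

q≤q² : ∀ q → q ℕ.≤ q ℕ.^ 2
q≤q² ℕ.zero      = ℕ.z≤n
q≤q² q@(ℕ.suc _) = ℕ.m≤m*n q (q ℕ.* 1)

1+[q²+q∸1]≡q²+q : ∀ q → 1 ℕ.≤ q → ℕ.suc (q ℕ.^ 2 ℕ.+ q ℕ.∸ 1) ≡ q ℕ.^ 2 ℕ.+ q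
1+[q²+q∸1]≡q²+q (ℕ.suc _) _ = ≡.refl

q+[q²∸q+1]≡q²+1 : ∀ q → q ℕ.+ (q ℕ.^ 2 ℕ.∸ q ℕ.+ 1) ≡ q ℕ.^ 2 ℕ.+ 1
q+[q²∸q+1]≡q²+1 q = ≡.trans (≡.sym (ℕ.+-assoc q _ 1)) (≡.cong (ℕ._+ 1) (ℕ.m+[n∸m]≡n (q≤q² q)))

Fin-injective⇒surjective : ∀ {n} (g : Fin n → Fin n) → Injective _≡_ _≡_ g →
                           ∀ j → ∃ λ i → g i ≡ j
Fin-injective⇒surjective {ℕ.suc k} g g-inj j with any? (λ i → g i ≟ᶠ j)
... | yes hit = hit
... | no miss = ⊥-elim (ℕ.1+n≰n (injective⇒≤ avoid-j-injective))
  where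
  avoid-j : Fin (ℕ.suc k) → Fin k
  avoid-j i = punchOut (λ j≡gi → miss (i , ≡.sym j≡gi))

  avoid-j-injective : Injective _≡_ _≡_ avoid-j
  avoid-j-injective = g-inj ∘ punchOut-injective {i = j} _ _

module FiniteSetoid {a ℓ} {S : Setoid a ℓ} {n} (enum : Inverse S (≡.setoid (Fin n))) where
  open Setoid S
  open Inverse enum

  infix 4 _≟_
  _≟_ : Decidable _≈_
  _≟_ = inj⇒≟ (Inverse⇒Injection enum)

  injective⇒surjective : (f : Carrier → Carrier) → (∀ x y → f x ≈ f y → x ≈ y) →
                         ∀ y → ∃ λ x → f x ≈ y
  injective⇒surjective f f-inj y =
    from i , trans (sym (strictlyInverseʳ _)) (trans (from-cong g-hits) (strictlyInverseʳ y))
    where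
    g : Fin n → Fin n
    g i = to (f (from i))

    g-injective : Injective _≡_ _≡_ g
    g-injective {i} {j} gi≡gj = ≡.trans (≡.sym (strictlyInverseˡ i))
      (≡.trans (to-cong (f-inj _ _ (trans (sym (strictlyInverseʳ _))
                                   (trans (from-cong gi≡gj) (strictlyInverseʳ _)))))
               (strictlyInverseˡ j))

    i = proj₁ (Fin-injective⇒surjective g g-injective (to y))
    g-hits = proj₂ (Fin-injective⇒surjective g g-injective (to y))

  induced-permutation : (h h⁻¹ : Carrier → Carrier) → (∀ {x y} → x ≈ y → h x ≈ h y) →
                        (∀ {x y} → x ≈ y → h⁻¹ x ≈ h⁻¹ y) →
                        (∀ x → h (h⁻¹ x) ≈ x) → (∀ x → h⁻¹ (h x) ≈ x) → Permutation n n
  induced-permutation h h⁻¹ h-cong h⁻¹-cong h∘h⁻¹ h⁻¹∘h =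
    permutation (λ i → to (h (from i))) (λ j → to (h⁻¹ (from j)))
      (λ j → ≡.trans (to-cong (trans (h-cong (strictlyInverseʳ _)) (h∘h⁻¹ (from j)))) (strictlyInverseˡ j))
      (λ j → ≡.trans (to-cong (trans (h⁻¹-cong (strictlyInverseʳ _)) (h⁻¹∘h (from j)))) (strictlyInverseˡ j))

module _ (R : CommutativeRing 0ℓ 0ℓ) (isField : IsField R) where
  open CommutativeRing R
  open import Algebra.Properties.CommutativeSemiring.Exp commutativeSemiring
    using (_^_; ^-congˡ; ^-congʳ; ^-homo-*; ^-assocʳ; ^-distrib-*)
  open import Relation.Binary.Reasoning.Setoid setoid

  pow≡^ : ∀ x k → pow R x k ≡ x ^ k
  pow≡^ x ℕ.zero    = ≡.refl
  pow≡^ x (ℕ.suc k) = ≡.cong (x *_) (pow≡^ x k)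

  1≉0 : 1# ≉ 0#
  1≉0 = proj₁ isField

  quotient : ∀ {d} → d ≉ 0# → ∀ y → ∃ λ z → d * z ≈ y
  quotient {d} d≉0 y with proj₂ isField d d≉0
  ... | d⁻¹ , dd⁻¹≈1 = d⁻¹ * y , trans (sym (*-assoc d d⁻¹ y)) (trans (*-congʳ dd⁻¹≈1) (*-identityˡ y))

  *-cancelˡ-nonzero : ∀ {c x y} → c ≉ 0# → c * x ≈ c * y → x ≈ y
  *-cancelˡ-nonzero {c} {x} {y} c≉0 cx≈cy with proj₂ isField c c≉0
  ... | d , cd≈1 = begin
    x              ≈⟨ *-identityˡ x ⟨
    1# * x         ≈⟨ *-congʳ (trans (*-comm d c) cd≈1) ⟨
    (d * c) * x    ≈⟨ *-assoc d c x ⟩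
    d * (c * x)    ≈⟨ *-congˡ cx≈cy ⟩
    d * (c * y)    ≈⟨ *-assoc d c y ⟨
    (d * c) * y    ≈⟨ *-congʳ (trans (*-comm d c) cd≈1) ⟩
    1# * y         ≈⟨ *-identityˡ y ⟩
    y              ∎

  *-cancelʳ-nonzero : ∀ {c x y} → c ≉ 0# → x * c ≈ y * c → x ≈ y
  *-cancelʳ-nonzero {c} {x} {y} c≉0 xc≈yc =
    *-cancelˡ-nonzero c≉0 (trans (*-comm c x) (trans xc≈yc (*-comm y c)))

  module DecidableField (_≟_ : Decidable _≈_) where
    zero-product : ∀ {x y} → x * y ≈ 0# → x ≈ 0# ⊎ y ≈ 0#
    zero-product {x} {y} xy≈0 with x ≟ 0#
    ... | yes x≈0 = inj₁ x≈0
    ... | no  x≉0 = inj₂ (*-cancelˡ-nonzero x≉0 (trans xy≈0 (sym (zeroʳ x))))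

    *-nonzero : ∀ {x y} → x ≉ 0# → y ≉ 0# → x * y ≉ 0#
    *-nonzero x≉0 y≉0 xy≈0 = [ x≉0 , y≉0 ]′ (zero-product xy≈0)

  module FiniteField {n} (card : HasCard R n) where
    open FiniteSetoid card public using (_≟_; injective⇒surjective)
    open FiniteSetoid card using (induced-permutation)
    open DecidableField _≟_ public
    open Inverse card using (to; from; to-cong; strictlyInverseˡ; strictlyInverseʳ)
    open import Algebra.Properties.CommutativeMonoid.Sum *-commutativeMonoid
      using (sum-remove; sum-replicate; ∑-permute; ∑-distrib-+; sum-cong-≋) renaming (sum to ∏)

    -- y ↦ x * y permutes the elements; zero↦one turns the product of all elements into the
    -- product of the nonzero ones, which therefore gets multiplied by x ^ (n - 1).
    zero↦one : Carrier → Carrier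
    zero↦one y with y ≟ 0#
    ... | yes _ = 1#
    ... | no  _ = y

    multiplier : Carrier → Carrier → Carrier
    multiplier x y with y ≟ 0#
    ... | yes _ = 1#
    ... | no  _ = x

    zero↦one-nonzero : ∀ y → zero↦one y ≉ 0#
    zero↦one-nonzero y with y ≟ 0#
    ... | yes _   = 1≉0
    ... | no  y≉0 = y≉0

    zero↦one-cong : ∀ {x y} → x ≈ y → zero↦one x ≈ zero↦one y
    zero↦one-cong {x} {y} x≈y with x ≟ 0# | y ≟ 0#
    ... | yes _   | yes _   = refl
    ... | yes x≈0 | no  y≉0 = ⊥-elim (y≉0 (trans (sym x≈y) x≈0))
    ... | no  x≉0 | yes y≈0 = ⊥-elim (x≉0 (trans x≈y y≈0))
    ... | no  _   | no  _   = x≈y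

    zero↦one-* : ∀ {x} y → x ≉ 0# → zero↦one (x * y) ≈ multiplier x y * zero↦one y
    zero↦one-* {x} y x≉0 with y ≟ 0# | x * y ≟ 0#
    ... | yes _   | yes _    = sym (*-identityˡ 1#)
    ... | yes y≈0 | no  xy≉0 = ⊥-elim (xy≉0 (trans (*-congˡ y≈0) (zeroʳ x)))
    ... | no  y≉0 | yes xy≈0 = ⊥-elim (*-nonzero x≉0 y≉0 xy≈0)
    ... | no  _   | no  _    = refl

    multiplier-zero : ∀ x {y} → y ≈ 0# → multiplier x y ≈ 1#
    multiplier-zero x {y} y≈0 with y ≟ 0#
    ... | yes _   = refl
    ... | no  y≉0 = ⊥-elim (y≉0 y≈0)

    multiplier-nonzero : ∀ x {y} → y ≉ 0# → multiplier x y ≈ x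
    multiplier-nonzero x {y} y≉0 with y ≟ 0#
    ... | yes y≈0 = ⊥-elim (y≉0 y≈0)
    ... | no  _   = refl

    ∏-nonzero : ∀ {k} (f : Fin k → Carrier) → (∀ i → f i ≉ 0#) → ∏ f ≉ 0#
    ∏-nonzero {ℕ.zero}  f f≉0 = 1≉0
    ∏-nonzero {ℕ.suc k} f f≉0 = *-nonzero (f≉0 Fin.zero) (∏-nonzero (f ∘ Fin.suc) (f≉0 ∘ Fin.suc))

    ∏-constant-but-one : ∀ {k} x (f : Fin k → Carrier) (i : Fin k) → f i ≈ 1# →
                         (∀ j → j ≢ i → f j ≈ x) → x * ∏ f ≈ x ^ k
    ∏-constant-but-one {ℕ.suc k} x f i fi≈1 fj≈x = begin
      x * ∏ f                                   ≈⟨ *-congˡ (sum-remove f) ⟩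
      x * (f i * ∏ (λ j → f (punchIn i j)))     ≈⟨ *-congˡ (*-cong fi≈1 (sum-cong-≋ λ j → fj≈x _ (punchInᵢ≢i i j))) ⟩
      x * (1# * ∏ {k} (λ _ → x))                ≈⟨ *-congˡ (trans (*-identityˡ _) (sum-replicate k)) ⟩
      x * x ^ k                                 ∎

    ^-card-nonzero : ∀ {x} → x ≉ 0# → x ^ n ≈ x
    ^-card-nonzero {x} x≉0 = begin
      x ^ n               ≈⟨ ∏-constant-but-one x (μ ∘ from) (to 0#) (multiplier-zero x (strictlyInverseʳ 0#)) μ≈x ⟨
      x * ∏ (μ ∘ from)    ≈⟨ *-congˡ ∏μ≈1 ⟩
      x * 1#              ≈⟨ *-identityʳ x ⟩
      x                   ∎
      where
      μ = multiplier x
      x⁻¹ = proj₁ (proj₂ isField x x≉0)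
      xx⁻¹≈1 = proj₂ (proj₂ isField x x≉0)
      P = ∏ (zero↦one ∘ from)

      μ≈x : ∀ i → i ≢ to 0# → μ (from i) ≈ x
      μ≈x i i≢0 = multiplier-nonzero x (λ from-i≈0 → i≢0 (≡.trans (≡.sym (strictlyInverseˡ i)) (to-cong from-i≈0)))

      times-x : Permutation n n
      times-x = induced-permutation (x *_) (x⁻¹ *_) *-congˡ *-congˡ
        (λ y → trans (sym (*-assoc x x⁻¹ y)) (trans (*-congʳ xx⁻¹≈1) (*-identityˡ y)))
        (λ y → trans (sym (*-assoc x⁻¹ x y)) (trans (*-congʳ (trans (*-comm x⁻¹ x) xx⁻¹≈1)) (*-identityˡ y)))

      P≈∏μ*P : P ≈ ∏ (μ ∘ from) * P
      P≈∏μ*P = begin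
        P                                          ≈⟨ ∑-permute (zero↦one ∘ from) times-x ⟩
        ∏ (λ i → zero↦one (from (times-x ⟨$⟩ʳ i))) ≈⟨ sum-cong-≋ (λ i → trans (zero↦one-cong (strictlyInverseʳ _)) (zero↦one-* (from i) x≉0)) ⟩
        ∏ (λ i → μ (from i) * zero↦one (from i))   ≈⟨ ∑-distrib-+ (μ ∘ from) (zero↦one ∘ from) ⟩
        ∏ (μ ∘ from) * P                           ∎

      ∏μ≈1 : ∏ (μ ∘ from) ≈ 1#
      ∏μ≈1 = *-cancelʳ-nonzero (∏-nonzero (zero↦one ∘ from) (zero↦one-nonzero ∘ from))
               (trans (sym P≈∏μ*P) (sym (*-identityˡ P)))

    ^-card : ∀ x → x ^ n ≈ x
    ^-card x with x ≟ 0#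
    ... | no  x≉0 = ^-card-nonzero x≉0
    ... | yes x≈0 = trans (^-congˡ n x≈0) (trans (0^positive (to 0#)) (sym x≈0))
      where
      0^positive : ∀ {k} → Fin k → 0# ^ k ≈ 0#
      0^positive {ℕ.suc k} _ = zeroˡ (0# ^ k)

    even-card⇒char2 : (∃ λ k → n ≡ 2 ℕ.* k) → 1# + 1# ≈ 0#
    even-card⇒char2 (k , n≡2k) = begin
      1# + 1#                 ≈⟨ +-congˡ -1≈1 ⟨
      1# + - 1#               ≈⟨ -‿inverseʳ 1# ⟩
      0#                      ∎
      where
      open import Algebra.Properties.Ring ring using (-1*x≈-x; -‿involutive)

      1^k≈1 : ∀ k → 1# ^ k ≈ 1#
      1^k≈1 ℕ.zero    = refl
      1^k≈1 (ℕ.suc k) = trans (*-identityˡ (1# ^ k)) (1^k≈1 k)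

      [-1]²≈1 : (- 1#) ^ 2 ≈ 1#
      [-1]²≈1 = trans (*-congˡ (*-identityʳ (- 1#))) (trans (-1*x≈-x (- 1#)) (-‿involutive 1#))

      -1≈1 : - 1# ≈ 1#
      -1≈1 = begin
        - 1#                  ≈⟨ ^-card (- 1#) ⟨
        (- 1#) ^ n            ≈⟨ ^-congʳ (- 1#) n≡2k ⟩
        (- 1#) ^ (2 ℕ.* k)    ≈⟨ ^-assocʳ (- 1#) 2 k ⟨
        ((- 1#) ^ 2) ^ k      ≈⟨ ^-congˡ k [-1]²≈1 ⟩
        1# ^ k                ≈⟨ 1^k≈1 k ⟩
        1#                    ∎

  module Characteristic2 (1+1≈0 : 1# + 1# ≈ 0#) where

    -- Ring solver with coefficients in 𝔽₂, so that it also proves identities valid only in characteristic 2.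
    𝔽₂ : RawRing 0ℓ 0ℓ
    𝔽₂ = record { Carrier = Bool ; _≈_ = _≡_ ; _+_ = _xor_ ; _*_ = _∧_ ; -_ = λ b → b
                ; 0# = false ; 1# = true }

    ⟦_⟧₂ : Bool → Carrier
    ⟦ b ⟧₂ = if b then 1# else 0#

    𝔽₂-morphism : 𝔽₂ -Raw-AlmostCommutative⟶ fromCommutativeRing R
    𝔽₂-morphism = record
      { ⟦_⟧ = ⟦_⟧₂
      ; +-homo = λ where
          false false → sym (+-identityˡ 0#)
          false true  → sym (+-identityˡ 1#)
          true  false → sym (+-identityʳ 1#)
          true  true  → sym 1+1≈0
      ; *-homo = λ where
          false y → sym (zeroˡ ⟦ y ⟧₂)
          true  y → sym (*-identityˡ ⟦ y ⟧₂)
      ; -‿homo = λ where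
          false → sym -0≈0
          true  → 1≈-1
      ; 0-homo = refl
      ; 1-homo = refl
      }
      where
      open import Algebra.Properties.Group +-group using () renaming (ε⁻¹≈ε to -0≈0)
      1≈-1 : 1# ≈ - 1#
      1≈-1 = begin
        1#                  ≈⟨ +-identityʳ 1# ⟨
        1# + 0#             ≈⟨ +-congˡ (-‿inverseʳ 1#) ⟨
        1# + (1# + - 1#)    ≈⟨ +-assoc 1# 1# (- 1#) ⟨
        (1# + 1#) + - 1#    ≈⟨ +-congʳ 1+1≈0 ⟩
        0# + - 1#           ≈⟨ +-identityˡ (- 1#) ⟩
        - 1#                ∎

    _≟₂_ : WeaklyDecidable (Induced-equivalence 𝔽₂-morphism)
    false ≟₂ false = just refl
    true  ≟₂ true  = just refl
    _     ≟₂ _     = nothing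

    open import Algebra.Solver.Ring 𝔽₂ (fromCommutativeRing R) 𝔽₂-morphism _≟₂_ public

    x+x≈0 : ∀ x → x + x ≈ 0#
    x+x≈0 = solve 1 (λ x → x :+ x := con false) refl

    x+y≈0⇒x≈y : ∀ {x y} → x + y ≈ 0# → x ≈ y
    x+y≈0⇒x≈y {x} {y} x+y≈0 = begin
      x              ≈⟨ solve 2 (λ x y → x := (x :+ y) :+ y) refl x y ⟩
      (x + y) + y    ≈⟨ +-congʳ x+y≈0 ⟩
      0# + y         ≈⟨ +-identityˡ y ⟩
      y              ∎

    frobenius : ∀ k x y → (x + y) ^ (2 ℕ.^ k) ≈ x ^ (2 ℕ.^ k) + y ^ (2 ℕ.^ k)
    frobenius ℕ.zero    x y = solve 2 (λ x y → (x :+ y) :* con true := x :* con true :+ y :* con true) refl x y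
    frobenius (ℕ.suc k) x y = begin
      (x + y) ^ (2 ℕ.* 2ᵏ)                 ≈⟨ ^-assocʳ (x + y) 2 2ᵏ ⟨
      ((x + y) ^ 2) ^ 2ᵏ                   ≈⟨ ^-congˡ 2ᵏ (solve 2 (λ x y → (x :+ y) :^ 2 := x :^ 2 :+ y :^ 2) refl x y) ⟩
      (x ^ 2 + y ^ 2) ^ 2ᵏ                 ≈⟨ frobenius k (x ^ 2) (y ^ 2) ⟩
      (x ^ 2) ^ 2ᵏ + (y ^ 2) ^ 2ᵏ          ≈⟨ +-cong (^-assocʳ x 2 2ᵏ) (^-assocʳ y 2 2ᵏ) ⟩
      x ^ (2 ℕ.* 2ᵏ) + y ^ (2 ℕ.* 2ᵏ)      ∎
      where 2ᵏ = 2 ℕ.^ k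

  module CubicAutomorphism (_≟_ : Decidable _≈_) (1+1≈0 : 1# + 1# ≈ 0#)
      (φ : Carrier → Carrier) (φ-cong : ∀ {x y} → x ≈ y → φ x ≈ φ y)
      (φ-+ : ∀ x y → φ (x + y) ≈ φ x + φ y) (φ-* : ∀ x y → φ (x * y) ≈ φ x * φ y)
      (φ³≈id : ∀ x → φ (φ (φ x)) ≈ x) where
    open DecidableField _≟_
    open Characteristic2 1+1≈0

    square-injective : ∀ {x y} → x * x ≈ y * y → x ≈ y
    square-injective {x} {y} x²≈y² = x+y≈0⇒x≈y ([ id , id ]′ (zero-product (begin
      (x + y) * (x + y)   ≈⟨ solve 2 (λ x y → (x :+ y) :* (x :+ y) := x :* x :+ y :* y) refl x y ⟩
      x * x + y * y       ≈⟨ +-congʳ x²≈y² ⟩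
      y * y + y * y       ≈⟨ x+x≈0 (y * y) ⟩
      0#                  ∎)))

    Fixed : Carrier → Set
    Fixed x = φ x ≈ x

    φ-injective : ∀ {x y} → φ x ≈ φ y → x ≈ y
    φ-injective {x} {y} φx≈φy = trans (sym (φ³≈id x)) (trans (φ-cong (φ-cong φx≈φy)) (φ³≈id y))

    φ-0 : φ 0# ≈ 0#
    φ-0 = begin
      φ 0#            ≈⟨ φ-cong (+-identityʳ 0#) ⟨
      φ (0# + 0#)     ≈⟨ φ-+ 0# 0# ⟩
      φ 0# + φ 0#     ≈⟨ x+x≈0 (φ 0#) ⟩
      0#              ∎

    φx≈0⇒x≈0 : ∀ {x} → φ x ≈ 0# → x ≈ 0#
    φx≈0⇒x≈0 φx≈0 = φ-injective (trans φx≈0 (sym φ-0))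

    φ-nonzero : ∀ {x} → x ≉ 0# → φ x ≉ 0#
    φ-nonzero x≉0 = x≉0 ∘ φx≈0⇒x≈0

    Fixed-cong : ∀ {x y} → x ≈ y → Fixed x → Fixed y
    Fixed-cong x≈y φx≈x = trans (φ-cong (sym x≈y)) (trans φx≈x x≈y)

    Fixed-φ : ∀ {x} → Fixed (φ x) → Fixed x
    Fixed-φ = φ-injective

    Fixed-+ : ∀ {x y} → Fixed x → Fixed y → Fixed (x + y)
    Fixed-+ {x} {y} φx≈x φy≈y = trans (φ-+ x y) (+-cong φx≈x φy≈y)

    Fixed-* : ∀ {x y} → Fixed x → Fixed y → Fixed (x * y)
    Fixed-* {x} {y} φx≈x φy≈y = trans (φ-* x y) (*-cong φx≈x φy≈y)

    Fixed-*-cancelˡ : ∀ {c x} → c ≉ 0# → Fixed c → Fixed (c * x) → Fixed x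
    Fixed-*-cancelˡ {c} {x} c≉0 φc≈c φcx≈cx =
      *-cancelˡ-nonzero c≉0 (trans (*-congʳ (sym φc≈c)) (trans (sym (φ-* c x)) φcx≈cx))

    Fixed-square⇒Fixed : ∀ {x} → Fixed (x * x) → Fixed x
    Fixed-square⇒Fixed {x} φx²≈x² = square-injective (trans (sym (φ-* x x)) φx²≈x²)

    e₁ e₂ e₃ : Carrier → Carrier → Carrier → Carrier
    e₁ u v w = (u + v) + w
    e₂ u v w = (u * v + v * w) + w * u
    e₃ u v w = (u * v) * w

    e₁-cong : ∀ {u u′ v v′ w w′} → u ≈ u′ → v ≈ v′ → w ≈ w′ → e₁ u v w ≈ e₁ u′ v′ w′
    e₁-cong u≈ v≈ w≈ = +-cong (+-cong u≈ v≈) w≈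

    e₂-cong : ∀ {u u′ v v′ w w′} → u ≈ u′ → v ≈ v′ → w ≈ w′ → e₂ u v w ≈ e₂ u′ v′ w′
    e₂-cong u≈ v≈ w≈ = +-cong (+-cong (*-cong u≈ v≈) (*-cong v≈ w≈)) (*-cong w≈ u≈)

    e₃-cong : ∀ {u u′ v v′ w w′} → u ≈ u′ → v ≈ v′ → w ≈ w′ → e₃ u v w ≈ e₃ u′ v′ w′
    e₃-cong u≈ v≈ w≈ = *-cong (*-cong u≈ v≈) w≈

    Tr E₂ Nm : Carrier → Carrier
    Tr x = e₁ x (φ x) (φ (φ x))
    E₂ x = e₂ x (φ x) (φ (φ x))
    Nm x = e₃ x (φ x) (φ (φ x))

    Tr-cong : ∀ {x y} → x ≈ y → Tr x ≈ Tr y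
    Tr-cong x≈y = e₁-cong x≈y (φ-cong x≈y) (φ-cong (φ-cong x≈y))

    E₂-cong : ∀ {x y} → x ≈ y → E₂ x ≈ E₂ y
    E₂-cong x≈y = e₂-cong x≈y (φ-cong x≈y) (φ-cong (φ-cong x≈y))

    Nm-cong : ∀ {x y} → x ≈ y → Nm x ≈ Nm y
    Nm-cong x≈y = e₃-cong x≈y (φ-cong x≈y) (φ-cong (φ-cong x≈y))

    Tr-Fixed : ∀ x → Fixed (Tr x)
    Tr-Fixed x = begin
      φ ((x + x₁) + x₂)     ≈⟨ trans (φ-+ (x + x₁) x₂) (+-congʳ (φ-+ x x₁)) ⟩
      (x₁ + x₂) + φ x₂      ≈⟨ +-congˡ (φ³≈id x) ⟩
      (x₁ + x₂) + x         ≈⟨ solve 3 (λ x x₁ x₂ → (x₁ :+ x₂) :+ x := (x :+ x₁) :+ x₂) refl x x₁ x₂ ⟩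
      (x + x₁) + x₂         ∎
      where x₁ = φ x; x₂ = φ x₁

    E₂-Fixed : ∀ x → Fixed (E₂ x)
    E₂-Fixed x = begin
      φ ((x * x₁ + x₁ * x₂) + x₂ * x)                ≈⟨ trans (φ-+ _ _) (+-cong (φ-+ _ _) (φ-* x₂ x)) ⟩
      (φ (x * x₁) + φ (x₁ * x₂)) + φ x₂ * x₁         ≈⟨ +-cong (+-cong (φ-* x x₁) (φ-* x₁ x₂)) (*-congʳ (φ³≈id x)) ⟩
      (x₁ * x₂ + x₂ * φ x₂) + x * x₁                 ≈⟨ +-congʳ (+-congˡ (*-congˡ (φ³≈id x))) ⟩
      (x₁ * x₂ + x₂ * x) + x * x₁                    ≈⟨ solve 3 (λ x x₁ x₂ → (x₁ :* x₂ :+ x₂ :* x) :+ x :* x₁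
                                                            := (x :* x₁ :+ x₁ :* x₂) :+ x₂ :* x) refl x x₁ x₂ ⟩
      (x * x₁ + x₁ * x₂) + x₂ * x                    ∎
      where x₁ = φ x; x₂ = φ x₁

    Nm-Fixed : ∀ x → Fixed (Nm x)
    Nm-Fixed x = begin
      φ ((x * x₁) * x₂)     ≈⟨ trans (φ-* (x * x₁) x₂) (*-congʳ (φ-* x x₁)) ⟩
      (x₁ * x₂) * φ x₂      ≈⟨ *-congˡ (φ³≈id x) ⟩
      (x₁ * x₂) * x         ≈⟨ solve 3 (λ x x₁ x₂ → (x₁ :* x₂) :* x := (x :* x₁) :* x₂) refl x x₁ x₂ ⟩
      (x * x₁) * x₂         ∎
      where x₁ = φ x; x₂ = φ x₁

    Nm-nonzero : ∀ {x} → x ≉ 0# → Nm x ≉ 0#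
    Nm-nonzero x≉0 = *-nonzero (*-nonzero x≉0 (φ-nonzero x≉0)) (φ-nonzero (φ-nonzero x≉0))

    Tr-on-Fixed : ∀ {x} → Fixed x → Tr x ≈ x
    Tr-on-Fixed {x} φx≈x = begin
      (x + φ x) + φ (φ x)   ≈⟨ +-cong (+-congˡ φx≈x) (trans (φ-cong φx≈x) φx≈x) ⟩
      (x + x) + x           ≈⟨ solve 1 (λ x → (x :+ x) :+ x := x) refl x ⟩
      x                     ∎

    Tr-+ : ∀ x y → Tr (x + y) ≈ Tr x + Tr y
    Tr-+ x y = begin
      (x + y + φ (x + y)) + φ (φ (x + y))              ≈⟨ +-cong (+-congˡ (φ-+ x y)) (trans (φ-cong (φ-+ x y)) (φ-+ (φ x) (φ y))) ⟩
      (x + y + (φ x + φ y)) + (φ (φ x) + φ (φ y))      ≈⟨ solve 6 (λ x x₁ x₂ y y₁ y₂ → (x :+ y :+ (x₁ :+ y₁)) :+ (x₂ :+ y₂)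
                                                            := ((x :+ x₁) :+ x₂) :+ ((y :+ y₁) :+ y₂)) refl x (φ x) (φ (φ x)) y (φ y) (φ (φ y)) ⟩
      Tr x + Tr y                                      ∎

    Tr-square : ∀ x → Tr (x * x) ≈ Tr x * Tr x
    Tr-square x = begin
      (x * x + φ (x * x)) + φ (φ (x * x))              ≈⟨ +-cong (+-congˡ (φ-* x x)) (trans (φ-cong (φ-* x x)) (φ-* (φ x) (φ x))) ⟩
      (x * x + x₁ * x₁) + x₂ * x₂                      ≈⟨ solve 3 (λ x x₁ x₂ → (x :* x :+ x₁ :* x₁) :+ x₂ :* x₂
                                                            := ((x :+ x₁) :+ x₂) :* ((x :+ x₁) :+ x₂)) refl x x₁ x₂ ⟩
      Tr x * Tr x                                      ∎
      where x₁ = φ x; x₂ = φ x₁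

    characteristic-polynomial : ∀ v → (v + Tr v) * (v * v) + (E₂ v * v + Nm v) ≈ 0#
    characteristic-polynomial v = solve 3 (λ v v₁ v₂ →
      (v :+ ((v :+ v₁) :+ v₂)) :* (v :* v) :+ (((v :* v₁ :+ v₁ :* v₂) :+ v₂ :* v) :* v :+ (v :* v₁) :* v₂)
        := con false) refl v (φ v) (φ (φ v))

    -- The hypotheses say that the characteristic polynomial of v is (X + Tr v)(X + b)².
    Fixed-of-split-charpoly : ∀ {b v} → Fixed b → E₂ v ≈ b * b → Nm v ≈ (b * b) * Tr v → Fixed v
    Fixed-of-split-charpoly {b} {v} φb≈b E₂≈b² Nm≈b²Tr =
      [ v≈Tr⇒Fixed ∘ x+y≈0⇒x≈y , [ v+b≈0⇒Fixed , v+b≈0⇒Fixed ]′ ∘ zero-product ]′ (zero-product (begin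
        (v + Tr v) * ((v + b) * (v + b))             ≈⟨ solve 3 (λ v t b → (v :+ t) :* ((v :+ b) :* (v :+ b))
                                                          := (v :+ t) :* (v :* v) :+ ((b :* b) :* v :+ (b :* b) :* t)) refl v (Tr v) b ⟩
        (v + Tr v) * (v * v) + ((b * b) * v + (b * b) * Tr v)
                                                     ≈⟨ +-congˡ (+-cong (*-congʳ E₂≈b²) Nm≈b²Tr) ⟨
        (v + Tr v) * (v * v) + (E₂ v * v + Nm v)     ≈⟨ characteristic-polynomial v ⟩
        0#                                           ∎))
      where
      v≈Tr⇒Fixed : v ≈ Tr v → Fixed v
      v≈Tr⇒Fixed v≈Tr = Fixed-cong (sym v≈Tr) (Tr-Fixed v)
      v+b≈0⇒Fixed : v + b ≈ 0# → Fixed v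
      v+b≈0⇒Fixed v+b≈0 = Fixed-cong (sym (x+y≈0⇒x≈y v+b≈0)) φb≈b

    module PermutationPolynomial (a : Carrier) (a-Fixed : Fixed a) (a≉0 : a ≉ 0#) (f : Carrier → Carrier)
        (Nm*f : ∀ x → Nm x * f x ≈ (φ (φ x) * φ (φ x)) * ((Nm x + a * (φ x * φ x)) + a * (x * x)))
        (f-zero : ∀ {x} → x ≈ 0# → f x ≈ 0#) where

      c : Carrier → Carrier
      c x = Nm x + a * (Tr x * Tr x)

      g : Carrier → Carrier → Carrier
      g γ y = a * (y * y) + γ * y

      c-Fixed : ∀ x → Fixed (c x)
      c-Fixed x = Fixed-+ (Nm-Fixed x) (Fixed-* a-Fixed (Fixed-* (Tr-Fixed x) (Tr-Fixed x)))

      g-congʳ : ∀ γ {y z} → y ≈ z → g γ y ≈ g γ z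
      g-congʳ γ y≈z = +-cong (*-congˡ (*-cong y≈z y≈z)) (*-congˡ y≈z)

      φ-g : ∀ {γ} → Fixed γ → ∀ y → φ (g γ y) ≈ g γ (φ y)
      φ-g {γ} φγ≈γ y = begin
        φ (a * (y * y) + γ * y)        ≈⟨ φ-+ _ _ ⟩
        φ (a * (y * y)) + φ (γ * y)    ≈⟨ +-cong (trans (φ-* a _) (*-cong a-Fixed (φ-* y y))) (trans (φ-* γ y) (*-congʳ φγ≈γ)) ⟩
        a * (φ y * φ y) + γ * φ y      ∎

      G₀ G₁ G₂ : Carrier → Carrier
      G₀ x = g (c x) (x * x)
      G₁ x = g (c x) (φ x * φ x)
      G₂ x = g (c x) (φ (φ x) * φ (φ x))

      module Syntax {k} (x x₁ x₂ a : Polynomial k) where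
        ê₁ ê₂ ê₃ : Polynomial k → Polynomial k → Polynomial k → Polynomial k
        ê₁ u v w = (u :+ v) :+ w
        ê₂ u v w = (u :* v :+ v :* w) :+ w :* u
        ê₃ u v w = (u :* v) :* w

        T̂ Ê N̂ ĉ κ̂ Ĝ₀ Ĝ₁ Ĝ₂ : Polynomial k
        T̂ = ê₁ x x₁ x₂
        Ê = ê₂ x x₁ x₂
        N̂ = ê₃ x x₁ x₂
        ĉ = N̂ :+ a :* (T̂ :* T̂)
        κ̂ = N̂ :* ĉ :+ (a :* a) :* (Ê :* Ê)
        Ĝ₀ = a :* ((x :* x) :* (x :* x)) :+ ĉ :* (x :* x)
        Ĝ₁ = a :* ((x₁ :* x₁) :* (x₁ :* x₁)) :+ ĉ :* (x₁ :* x₁)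
        Ĝ₂ = a :* ((x₂ :* x₂) :* (x₂ :* x₂)) :+ ĉ :* (x₂ :* x₂)

      Nm*f≈G₂ : ∀ x → Nm x * f x ≈ G₂ x
      Nm*f≈G₂ x = trans (Nm*f x) (solve 4 (λ x x₁ x₂ a → let open Syntax x x₁ x₂ a in
        (x₂ :* x₂) :* ((N̂ :+ a :* (x₁ :* x₁)) :+ a :* (x :* x)) := Ĝ₂) refl x (φ x) (φ (φ x)) a)

      Nm*φ-conjugate : ∀ x {v z} → Nm x * v ≈ g (c x) (z * z) → Nm x * φ v ≈ g (c x) (φ z * φ z)
      Nm*φ-conjugate x {v} {z} Nv≈gz = begin
        Nm x * φ v             ≈⟨ *-congʳ (Nm-Fixed x) ⟨
        φ (Nm x) * φ v         ≈⟨ φ-* (Nm x) v ⟨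
        φ (Nm x * v)           ≈⟨ φ-cong Nv≈gz ⟩
        φ (g (c x) (z * z))    ≈⟨ φ-g (c-Fixed x) (z * z) ⟩
        g (c x) (φ (z * z))    ≈⟨ g-congʳ (c x) (φ-* z z) ⟩
        g (c x) (φ z * φ z)    ∎

      Nm*φf≈G₀ : ∀ x → Nm x * φ (f x) ≈ G₀ x
      Nm*φf≈G₀ x = trans (Nm*φ-conjugate x (Nm*f≈G₂ x)) (g-congʳ (c x) (*-cong (φ³≈id x) (φ³≈id x)))

      Nm*φφf≈G₁ : ∀ x → Nm x * φ (φ (f x)) ≈ G₁ x
      Nm*φφf≈G₁ x = Nm*φ-conjugate x (Nm*φf≈G₀ x)

      f-on-Fixed : ∀ {x} → Fixed x → f x ≈ x * x
      f-on-Fixed {x} φx≈x with x ≟ 0#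
      ... | yes x≈0 = trans (f-zero x≈0) (sym (trans (*-congˡ x≈0) (zeroʳ x)))
      ... | no  x≉0 = *-cancelˡ-nonzero (Nm-nonzero x≉0) (begin
        Nm x * f x                                         ≈⟨ Nm*f x ⟩
        (x₂ * x₂) * ((Nm x + a * (x₁ * x₁)) + a * (x * x)) ≈⟨ *-cong (*-cong x₂≈x x₂≈x) (+-congʳ (+-congˡ (*-congˡ (*-cong φx≈x φx≈x)))) ⟩
        (x * x) * ((Nm x + a * (x * x)) + a * (x * x))     ≈⟨ solve 3 (λ N a y → y :* ((N :+ a :* y) :+ a :* y) := N :* y) refl (Nm x) a (x * x) ⟩
        Nm x * (x * x)                                     ∎)
        where
        x₁ = φ x; x₂ = φ x₁
        x₂≈x : x₂ ≈ x
        x₂≈x = trans (φ-cong φx≈x) φx≈x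

      Fixed-f⇒Fixed : ∀ {x} → Fixed (f x) → Fixed x
      Fixed-f⇒Fixed {x} φfx≈fx = [ x₀²≈x₂²⇒Fixed ∘ x+y≈0⇒x≈y , N≈ax₁²⇒Fixed ∘ x+y≈0⇒x≈y ]′ (zero-product (begin
        (x * x + x₂ * x₂) * (Nm x + a * (x₁ * x₁))          ≈⟨ solve 4 (λ x x₁ x₂ a → let open Syntax x x₁ x₂ a in
                                                                 (x :* x :+ x₂ :* x₂) :* (N̂ :+ a :* (x₁ :* x₁)) := Ĝ₂ :+ Ĝ₀) refl x x₁ x₂ a ⟩
        G₂ x + G₀ x                                         ≈⟨ +-cong (Nm*f≈G₂ x) (Nm*φf≈G₀ x) ⟨
        Nm x * f x + Nm x * φ (f x)                         ≈⟨ +-congˡ (*-congˡ φfx≈fx) ⟩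
        Nm x * f x + Nm x * f x                             ≈⟨ x+x≈0 (Nm x * f x) ⟩
        0#                                                  ∎))
        where
        x₁ = φ x; x₂ = φ x₁
        x₀²≈x₂²⇒Fixed : x * x ≈ x₂ * x₂ → Fixed x
        x₀²≈x₂²⇒Fixed x₀²≈x₂² = trans (φ-cong (square-injective x₀²≈x₂²)) (φ³≈id x)
        N≈ax₁²⇒Fixed : Nm x ≈ a * (x₁ * x₁) → Fixed x
        N≈ax₁²⇒Fixed N≈ax₁² = Fixed-φ (Fixed-square⇒Fixed
          (Fixed-*-cancelˡ a≉0 a-Fixed (trans (φ-cong (sym N≈ax₁²)) (trans (Nm-Fixed x) N≈ax₁²))))

      Nm*Tr-f : ∀ x → Nm x * Tr (f x) ≈ e₁ (G₂ x) (G₀ x) (G₁ x)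
      Nm*Tr-f x = trans (solve 4 (λ N u v w → N :* ((u :+ v) :+ w) := (N :* u :+ N :* v) :+ N :* w)
                               refl (Nm x) (f x) (φ (f x)) (φ (φ (f x))))
                        (e₁-cong (Nm*f≈G₂ x) (Nm*φf≈G₀ x) (Nm*φφf≈G₁ x))

      Nm²*E₂-f : ∀ x → (Nm x * Nm x) * E₂ (f x) ≈ e₂ (G₂ x) (G₀ x) (G₁ x)
      Nm²*E₂-f x = trans (solve 4 (λ N u v w → (N :* N) :* ((u :* v :+ v :* w) :+ w :* u)
                                    := ((N :* u) :* (N :* v) :+ (N :* v) :* (N :* w)) :+ (N :* w) :* (N :* u))
                                refl (Nm x) (f x) (φ (f x)) (φ (φ (f x))))
                         (e₂-cong (Nm*f≈G₂ x) (Nm*φf≈G₀ x) (Nm*φφf≈G₁ x))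

      Nm³*Nm-f : ∀ x → ((Nm x * Nm x) * Nm x) * Nm (f x) ≈ e₃ (G₂ x) (G₀ x) (G₁ x)
      Nm³*Nm-f x = trans (solve 4 (λ N u v w → ((N :* N) :* N) :* ((u :* v) :* w) := ((N :* u) :* (N :* v)) :* (N :* w))
                                refl (Nm x) (f x) (φ (f x)) (φ (φ (f x))))
                         (e₃-cong (Nm*f≈G₂ x) (Nm*φf≈G₀ x) (Nm*φφf≈G₁ x))

      Tr-f : ∀ {x} → x ≉ 0# → Tr (f x) ≈ Tr x * Tr x
      Tr-f {x} x≉0 = *-cancelˡ-nonzero (Nm-nonzero x≉0) (trans (Nm*Tr-f x)
        (solve 4 (λ x x₁ x₂ a → let open Syntax x x₁ x₂ a in ê₁ Ĝ₂ Ĝ₀ Ĝ₁ := N̂ :* (T̂ :* T̂)) refl x (φ x) (φ (φ x)) a))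

      a² a³ a⁴ : Carrier
      a² = a * a
      a³ = a² * a
      a⁴ = a² * a²

      κ : Carrier → Carrier
      κ x = Nm x * c x + a² * (E₂ x * E₂ x)

      ζ : Carrier → Carrier
      ζ v = (Nm v + a² * E₂ v) + a⁴ * Tr v

      κ²≈Nm²ζ : ∀ {x} → x ≉ 0# → κ x * κ x ≈ (Nm x * Nm x) * ζ (f x)
      κ²≈Nm²ζ {x} x≉0 = *-cancelˡ-nonzero (Nm-nonzero x≉0) (begin
        N * (κ x * κ x)                                                  ≈⟨ solve 4 (λ x x₁ x₂ a → let open Syntax x x₁ x₂ a in
                                                                              N̂ :* (κ̂ :* κ̂) := (ê₃ Ĝ₂ Ĝ₀ Ĝ₁ :+ (a :* a) :* (N̂ :* ê₂ Ĝ₂ Ĝ₀ Ĝ₁))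
                                                                                               :+ ((a :* a) :* (a :* a)) :* ((N̂ :* N̂) :* ê₁ Ĝ₂ Ĝ₀ Ĝ₁))
                                                                            refl x (φ x) (φ (φ x)) a ⟩
        (e₃ G₂′ G₀′ G₁′ + a² * (N * e₂ G₂′ G₀′ G₁′)) + a⁴ * ((N * N) * e₁ G₂′ G₀′ G₁′)
                                                                         ≈⟨ +-cong (+-cong (Nm³*Nm-f x) (*-congˡ (*-congˡ (Nm²*E₂-f x))))
                                                                                   (*-congˡ (*-congˡ (Nm*Tr-f x))) ⟨
        (((N * N) * N) * Nm v + a² * (N * ((N * N) * E₂ v))) + a⁴ * ((N * N) * (N * Tr v))
                                                                         ≈⟨ solve 6 (λ N u₁ u₂ u₃ a² a⁴ →
                                                                              (((N :* N) :* N) :* u₃ :+ a² :* (N :* ((N :* N) :* u₂))) :+ a⁴ :* ((N :* N) :* (N :* u₁))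
                                                                                := N :* ((N :* N) :* ((u₃ :+ a² :* u₂) :+ a⁴ :* u₁)))
                                                                            refl N (Tr v) (E₂ v) (Nm v) a² a⁴ ⟩
        N * ((N * N) * ζ v)                                              ∎)
        where
        N = Nm x; v = f x
        G₀′ = G₀ x; G₁′ = G₁ x; G₂′ = G₂ x

      E₂²-relation : ∀ x → (E₂ x * E₂ x) * (κ x + a³ * Nm x) ≈ (Nm x * Nm x) * E₂ (f x) + a * (Nm x * κ x)
      E₂²-relation x = begin
        (E₂ x * E₂ x) * (κ x + a³ * Nm x)               ≈⟨ solve 4 (λ x x₁ x₂ a → let open Syntax x x₁ x₂ a in
                                                             (Ê :* Ê) :* (κ̂ :+ ((a :* a) :* a) :* N̂) := ê₂ Ĝ₂ Ĝ₀ Ĝ₁ :+ a :* (N̂ :* κ̂))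
                                                           refl x (φ x) (φ (φ x)) a ⟩
        e₂ (G₂ x) (G₀ x) (G₁ x) + a * (Nm x * κ x)      ≈⟨ +-congʳ (Nm²*E₂-f x) ⟨
        (Nm x * Nm x) * E₂ (f x) + a * (Nm x * κ x)     ∎

      κ≈a³Nm⇒Fixed-f : ∀ {x} → x ≉ 0# → κ x ≈ a³ * Nm x → Fixed (f x)
      κ≈a³Nm⇒Fixed-f {x} x≉0 κ≈a³N = Fixed-of-split-charpoly (Fixed-* a-Fixed a-Fixed) E₂v≈a⁴ Nmv≈a⁴Trv
        where
        N = Nm x; v = f x
        N²≉0 = *-nonzero (Nm-nonzero x≉0) (Nm-nonzero x≉0)

        E₂v≈a⁴ : E₂ v ≈ a⁴
        E₂v≈a⁴ = *-cancelˡ-nonzero N²≉0 (begin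
          (N * N) * E₂ v       ≈⟨ x+y≈0⇒x≈y (trans (sym (E₂²-relation x)) (begin
                                    (E₂ x * E₂ x) * (κ x + a³ * N)      ≈⟨ *-congˡ (+-congʳ κ≈a³N) ⟩
                                    (E₂ x * E₂ x) * (a³ * N + a³ * N)   ≈⟨ *-congˡ (x+x≈0 (a³ * N)) ⟩
                                    (E₂ x * E₂ x) * 0#                  ≈⟨ zeroʳ _ ⟩
                                    0#                                  ∎)) ⟩
          a * (N * κ x)        ≈⟨ *-congˡ (*-congˡ κ≈a³N) ⟩
          a * (N * (a³ * N))   ≈⟨ solve 2 (λ a N → a :* (N :* (((a :* a) :* a) :* N)) := (N :* N) :* ((a :* a) :* (a :* a))) refl a N ⟩
          (N * N) * a⁴         ∎)

        ζv≈a³a³ : ζ v ≈ a³ * a³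
        ζv≈a³a³ = *-cancelˡ-nonzero N²≉0 (begin
          (N * N) * ζ v        ≈⟨ κ²≈Nm²ζ x≉0 ⟨
          κ x * κ x            ≈⟨ *-cong κ≈a³N κ≈a³N ⟩
          (a³ * N) * (a³ * N)  ≈⟨ solve 2 (λ A N → (A :* N) :* (A :* N) := (N :* N) :* (A :* A)) refl a³ N ⟩
          (N * N) * (a³ * a³)  ∎)

        Nmv≈a⁴Trv : Nm v ≈ a⁴ * Tr v
        Nmv≈a⁴Trv = x+y≈0⇒x≈y (begin
          Nm v + a⁴ * Tr v                      ≈⟨ solve 4 (λ n e t a → n :+ ((a :* a) :* (a :* a)) :* t
                                                     := ((((n :+ (a :* a) :* e) :+ ((a :* a) :* (a :* a)) :* t)
                                                          :+ (a :* a) :* (e :+ (a :* a) :* (a :* a)))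
                                                         :+ ((a :* a) :* a) :* ((a :* a) :* a))) refl (Nm v) (E₂ v) (Tr v) a ⟩
          (ζ v + a² * (E₂ v + a⁴)) + a³ * a³    ≈⟨ +-congʳ (+-cong ζv≈a³a³ (*-congˡ (+-congʳ E₂v≈a⁴))) ⟩
          (a³ * a³ + a² * (a⁴ + a⁴)) + a³ * a³  ≈⟨ solve 1 (λ a → let a³ = (a :* a) :* a; a⁴ = (a :* a) :* (a :* a) in
                                                     (a³ :* a³ :+ (a :* a) :* (a⁴ :+ a⁴)) :+ a³ :* a³ := con false) refl a ⟩
          0#                                    ∎)

      ζ-cong : ∀ {u v} → u ≈ v → ζ u ≈ ζ v
      ζ-cong u≈v = +-cong (+-cong (Nm-cong u≈v) (*-congˡ (E₂-cong u≈v))) (*-congˡ (Tr-cong u≈v))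

      -- H = κ/Nm and ε = E₂²/Nm are determined by f x (ε only when H ≠ a³), and c = H + a²ε.
      module Quotients {x} (x≉0 : x ≉ 0#) where
        private
          N = Nm x
          N≉0 = Nm-nonzero x≉0
          N²≉0 = *-nonzero N≉0 N≉0

        H ε : Carrier
        H = proj₁ (quotient N≉0 (κ x))
        ε = proj₁ (quotient N≉0 (E₂ x * E₂ x))

        N*H≈κ : N * H ≈ κ x
        N*H≈κ = proj₂ (quotient N≉0 (κ x))

        N*ε≈E₂² : N * ε ≈ E₂ x * E₂ x
        N*ε≈E₂² = proj₂ (quotient N≉0 (E₂ x * E₂ x))

        H²≈ζ : H * H ≈ ζ (f x)
        H²≈ζ = *-cancelˡ-nonzero N²≉0 (begin
          (N * N) * (H * H)    ≈⟨ solve 2 (λ N H → (N :* N) :* (H :* H) := (N :* H) :* (N :* H)) refl N H ⟩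
          (N * H) * (N * H)    ≈⟨ *-cong N*H≈κ N*H≈κ ⟩
          κ x * κ x            ≈⟨ κ²≈Nm²ζ x≉0 ⟩
          (N * N) * ζ (f x)    ∎)

        ε-relation : ε * (H + a³) ≈ E₂ (f x) + a * H
        ε-relation = *-cancelˡ-nonzero N²≉0 (begin
          (N * N) * (ε * (H + a³))               ≈⟨ solve 4 (λ N H ε A → (N :* N) :* (ε :* (H :+ A)) := (N :* ε) :* (N :* H :+ A :* N)) refl N H ε a³ ⟩
          (N * ε) * (N * H + a³ * N)             ≈⟨ *-cong N*ε≈E₂² (+-congʳ N*H≈κ) ⟩
          (E₂ x * E₂ x) * (κ x + a³ * N)         ≈⟨ E₂²-relation x ⟩
          (N * N) * E₂ (f x) + a * (N * κ x)     ≈⟨ +-congˡ (*-congˡ (*-congˡ N*H≈κ)) ⟨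
          (N * N) * E₂ (f x) + a * (N * (N * H)) ≈⟨ solve 4 (λ N e a H → (N :* N) :* e :+ a :* (N :* (N :* H)) := (N :* N) :* (e :+ a :* H)) refl N (E₂ (f x)) a H ⟩
          (N * N) * (E₂ (f x) + a * H)           ∎)

        c≈H+a²ε : c x ≈ H + a² * ε
        c≈H+a²ε = *-cancelˡ-nonzero N≉0 (begin
          N * c x                                 ≈⟨ solve 2 (λ u v → u := (u :+ v) :+ v) refl (N * c x) (a² * (E₂ x * E₂ x)) ⟩
          κ x + a² * (E₂ x * E₂ x)                ≈⟨ +-cong N*H≈κ (*-congˡ N*ε≈E₂²) ⟨
          N * H + a² * (N * ε)                    ≈⟨ solve 4 (λ N H A ε → N :* H :+ A :* (N :* ε) := N :* (H :+ A :* ε)) refl N H a² ε ⟩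
          N * (H + a² * ε)                        ∎)

        H+a³≉0 : ¬ Fixed (f x) → H + a³ ≉ 0#
        H+a³≉0 ¬fixed H+a³≈0 = ¬fixed (κ≈a³Nm⇒Fixed-f x≉0 (begin
          κ x       ≈⟨ N*H≈κ ⟨
          N * H     ≈⟨ *-congˡ (x+y≈0⇒x≈y H+a³≈0) ⟩
          N * a³    ≈⟨ *-comm N a³ ⟩
          a³ * N    ∎))

      open Quotients using (H; ε; H²≈ζ; ε-relation; c≈H+a²ε; H+a³≉0)

      c-determined : ∀ {x x′} (x≉0 : x ≉ 0#) (x′≉0 : x′ ≉ 0#) → f x ≈ f x′ → ¬ Fixed (f x) → c x ≈ c x′
      c-determined {x} {x′} x≉0 x′≉0 fx≈fx′ ¬fixed = begin
        c x                          ≈⟨ c≈H+a²ε x≉0 ⟩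
        H x≉0 + a² * ε x≉0           ≈⟨ +-cong H≈H′ (*-congˡ ε≈ε′) ⟩
        H x′≉0 + a² * ε x′≉0         ≈⟨ c≈H+a²ε x′≉0 ⟨
        c x′                         ∎
        where
        H≈H′ : H x≉0 ≈ H x′≉0
        H≈H′ = square-injective (trans (H²≈ζ x≉0) (trans (ζ-cong fx≈fx′) (sym (H²≈ζ x′≉0))))

        ε≈ε′ : ε x≉0 ≈ ε x′≉0
        ε≈ε′ = *-cancelʳ-nonzero (H+a³≉0 x≉0 ¬fixed) (begin
          ε x≉0 * (H x≉0 + a³)          ≈⟨ ε-relation x≉0 ⟩
          E₂ (f x) + a * H x≉0          ≈⟨ +-cong (E₂-cong fx≈fx′) (*-congˡ H≈H′) ⟩
          E₂ (f x′) + a * H x′≉0        ≈⟨ ε-relation x′≉0 ⟨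
          ε x′≉0 * (H x′≉0 + a³)        ≈⟨ *-congˡ (+-congʳ H≈H′) ⟨
          ε x′≉0 * (H x≉0 + a³)         ∎)

      Tr-determined : ∀ {x x′} → x ≉ 0# → x′ ≉ 0# → f x ≈ f x′ → Tr x ≈ Tr x′
      Tr-determined x≉0 x′≉0 fx≈fx′ = square-injective (trans (sym (Tr-f x≉0)) (trans (Tr-cong fx≈fx′) (Tr-f x′≉0)))

      g-collision : ∀ {γ y z} → g γ y ≈ g γ z → y + z ≈ 0# ⊎ a * (y + z) ≈ γ
      g-collision {γ} {y} {z} gy≈gz = map₂ x+y≈0⇒x≈y (zero-product (begin
        (y + z) * (a * (y + z) + γ)    ≈⟨ solve 4 (λ a γ y z → (y :+ z) :* (a :* (y :+ z) :+ γ)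
                                            := (a :* (y :* y) :+ γ :* y) :+ (a :* (z :* z) :+ γ :* z)) refl a γ y z ⟩
        g γ y + g γ z                  ≈⟨ +-congʳ gy≈gz ⟩
        g γ z + g γ z                  ≈⟨ x+x≈0 (g γ z) ⟩
        0#                             ∎))

      -- δ = x² + x′² has trace 0, and φ² δ is either 0 or c/a ∈ 𝔽_q; in the second case δ = Tr δ = 0.
      equal-of-same-Tr-and-c : ∀ {x x′} → Tr x ≈ Tr x′ → c x ≈ c x′ → f x ≈ f x′ → x ≈ x′
      equal-of-same-Tr-and-c {x} {x′} T≈T′ c≈c′ fx≈fx′ = square-injective (x+y≈0⇒x≈y δ≈0)
        where
        δ = x * x + x′ * x′

        Nm≈c+aT² : ∀ y → Nm y ≈ c y + a * (Tr y * Tr y)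
        Nm≈c+aT² y = solve 2 (λ u v → u := (u :+ v) :+ v) refl (Nm y) (a * (Tr y * Tr y))

        N≈N′ : Nm x ≈ Nm x′
        N≈N′ = trans (Nm≈c+aT² x) (trans (+-cong c≈c′ (*-congˡ (*-cong T≈T′ T≈T′))) (sym (Nm≈c+aT² x′)))

        G₂-collision : g (c x) (φ (φ x) * φ (φ x)) ≈ g (c x) (φ (φ x′) * φ (φ x′))
        G₂-collision = begin
          G₂ x                                 ≈⟨ Nm*f≈G₂ x ⟨
          Nm x * f x                           ≈⟨ *-cong N≈N′ fx≈fx′ ⟩
          Nm x′ * f x′                         ≈⟨ Nm*f≈G₂ x′ ⟩
          G₂ x′                                ≈⟨ +-congˡ (*-congʳ (sym c≈c′)) ⟩
          g (c x) (φ (φ x′) * φ (φ x′))        ∎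

        φφδ : φ (φ x) * φ (φ x) + φ (φ x′) * φ (φ x′) ≈ φ (φ δ)
        φφδ = sym (trans (φ-cong (φ-+ _ _)) (trans (φ-+ _ _) (+-cong (trans (φ-cong (φ-* x x)) (φ-* _ _))
                                                                      (trans (φ-cong (φ-* x′ x′)) (φ-* _ _)))))

        Trδ≈0 : Tr δ ≈ 0#
        Trδ≈0 = begin
          Tr δ                             ≈⟨ Tr-+ (x * x) (x′ * x′) ⟩
          Tr (x * x) + Tr (x′ * x′)        ≈⟨ +-cong (Tr-square x) (Tr-square x′) ⟩
          Tr x * Tr x + Tr x′ * Tr x′      ≈⟨ +-congʳ (*-cong T≈T′ T≈T′) ⟩
          Tr x′ * Tr x′ + Tr x′ * Tr x′    ≈⟨ x+x≈0 _ ⟩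
          0#                               ∎

        δ≈0 : δ ≈ 0#
        δ≈0 = [ (λ y₂+y₂′≈0 → φx≈0⇒x≈0 (φx≈0⇒x≈0 (trans (sym φφδ) y₂+y₂′≈0)))
              , (λ a[y₂+y₂′]≈c → trans (sym (Tr-on-Fixed (δ-Fixed a[y₂+y₂′]≈c))) Trδ≈0)
              ]′ (g-collision G₂-collision)
          where
          δ-Fixed : a * (φ (φ x) * φ (φ x) + φ (φ x′) * φ (φ x′)) ≈ c x → Fixed δ
          δ-Fixed a[y₂+y₂′]≈c = Fixed-φ (Fixed-φ (Fixed-cong φφδ
            (Fixed-*-cancelˡ a≉0 a-Fixed (Fixed-cong (sym a[y₂+y₂′]≈c) (c-Fixed x)))))

      nonfixed-value⇒nonzero : ∀ {x} → ¬ Fixed (f x) → x ≉ 0#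
      nonfixed-value⇒nonzero ¬fixed x≈0 = ¬fixed (Fixed-cong (sym (f-zero x≈0)) φ-0)

      f-injective : ∀ x x′ → f x ≈ f x′ → x ≈ x′
      f-injective x x′ fx≈fx′ with φ (f x) ≟ f x
      ... | yes fixed = square-injective (begin
        x * x     ≈⟨ f-on-Fixed (Fixed-f⇒Fixed fixed) ⟨
        f x       ≈⟨ fx≈fx′ ⟩
        f x′      ≈⟨ f-on-Fixed (Fixed-f⇒Fixed (Fixed-cong fx≈fx′ fixed)) ⟩
        x′ * x′   ∎)
      ... | no ¬fixed = equal-of-same-Tr-and-c (Tr-determined x≉0 x′≉0 fx≈fx′) (c-determined x≉0 x′≉0 fx≈fx′ ¬fixed) fx≈fx′
        where
        x≉0 = nonfixed-value⇒nonzero ¬fixed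
        x′≉0 = nonfixed-value⇒nonzero (¬fixed ∘ Fixed-cong (sym fx≈fx′))

  module CubicExtensionOfF₂ᵐ (m : ℕ.ℕ) (1≤m : 1 ℕ.≤ m)
                            (card : HasCard R ((2 ℕ.^ m) ℕ.^ 3)) where
    open FiniteField card

    q : ℕ.ℕ
    q = 2 ℕ.^ m

    1≤q : 1 ℕ.≤ q
    1≤q = ℕ.m^n>0 2 m

    1+1≈0 : 1# + 1# ≈ 0#
    1+1≈0 = even-card⇒char2 (2ᵐ-cubed-even m 1≤m)

    φ : Carrier → Carrier
    φ x = x ^ q

    open Characteristic2 1+1≈0

    φ-cong : ∀ {x y} → x ≈ y → φ x ≈ φ y
    φ-cong = ^-congˡ q

    φ-+ : ∀ x y → φ (x + y) ≈ φ x + φ y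
    φ-+ = frobenius m

    φ-* : ∀ x y → φ (x * y) ≈ φ x * φ y
    φ-* x y = ^-distrib-* x y q

    φ³≈id : ∀ x → φ (φ (φ x)) ≈ x
    φ³≈id x = begin
      ((x ^ q) ^ q) ^ q          ≈⟨ φ-cong (^-assocʳ x q q) ⟩
      (x ^ (q ℕ.* q)) ^ q        ≈⟨ ^-assocʳ x (q ℕ.* q) q ⟩
      x ^ ((q ℕ.* q) ℕ.* q)      ≈⟨ ^-congʳ x q*q*q≡q³ ⟩
      x ^ (q ℕ.^ 3)              ≈⟨ ^-card x ⟩
      x                          ∎
      where
      q*q*q≡q³ : (q ℕ.* q) ℕ.* q ≡ q ℕ.^ 3
      q*q*q≡q³ = ≡.trans (ℕ.*-assoc q q q) (≡.cong (λ t → q ℕ.* (q ℕ.* t)) (≡.sym (ℕ.*-identityʳ q)))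

    open CubicAutomorphism _≟_ 1+1≈0 φ φ-cong φ-+ φ-* φ³≈id public

    x^q²≈φφx : ∀ x → x ^ (q ℕ.^ 2) ≈ φ (φ x)
    x^q²≈φφx x = trans (^-congʳ x (≡.cong (q ℕ.*_) (ℕ.*-identityʳ q))) (sym (^-assocʳ x q q))

    pow-[2q²] : ∀ x → pow R x (2 ℕ.* q ℕ.^ 2) ≈ φ (φ x) * φ (φ x)
    pow-[2q²] x = begin
      pow R x (2 ℕ.* q²)         ≡⟨ pow≡^ x (2 ℕ.* q²) ⟩
      x ^ (2 ℕ.* q²)             ≈⟨ ^-congʳ x (ℕ.*-comm 2 q²) ⟩
      x ^ (q² ℕ.* 2)             ≈⟨ ^-assocʳ x q² 2 ⟨
      x ^ q² * (x ^ q² * 1#)     ≈⟨ *-congˡ (*-identityʳ (x ^ q²)) ⟩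
      x ^ q² * x ^ q²            ≈⟨ *-cong (x^q²≈φφx x) (x^q²≈φφx x) ⟩
      φ (φ x) * φ (φ x)          ∎
      where q² = q ℕ.^ 2

    x*pow-[q²+q∸1] : ∀ x → x * pow R x (q ℕ.^ 2 ℕ.+ q ℕ.∸ 1) ≈ φ (φ x) * φ x
    x*pow-[q²+q∸1] x = begin
      pow R x (ℕ.suc (q² ℕ.+ q ℕ.∸ 1))   ≡⟨ ≡.cong (pow R x) (1+[q²+q∸1]≡q²+q q 1≤q) ⟩
      pow R x (q² ℕ.+ q)                 ≡⟨ pow≡^ x (q² ℕ.+ q) ⟩
      x ^ (q² ℕ.+ q)                     ≈⟨ ^-homo-* x q² q ⟩
      x ^ q² * x ^ q                     ≈⟨ *-congʳ (x^q²≈φφx x) ⟩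
      φ (φ x) * φ x                      ∎
      where q² = q ℕ.^ 2

    φx*pow-[q²∸q+1] : ∀ x → φ x * pow R x (q ℕ.^ 2 ℕ.∸ q ℕ.+ 1) ≈ φ (φ x) * x
    φx*pow-[q²∸q+1] x = begin
      x ^ q * pow R x (q² ℕ.∸ q ℕ.+ 1)   ≡⟨ ≡.cong (x ^ q *_) (pow≡^ x (q² ℕ.∸ q ℕ.+ 1)) ⟩
      x ^ q * x ^ (q² ℕ.∸ q ℕ.+ 1)       ≈⟨ ^-homo-* x q _ ⟨
      x ^ (q ℕ.+ (q² ℕ.∸ q ℕ.+ 1))       ≈⟨ ^-congʳ x (q+[q²∸q+1]≡q²+1 q) ⟩
      x ^ (q² ℕ.+ 1)                     ≈⟨ ^-homo-* x q² 1 ⟩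
      x ^ q² * (x * 1#)                  ≈⟨ *-cong (x^q²≈φφx x) (*-identityʳ x) ⟩
      φ (φ x) * x                        ∎
      where q² = q ℕ.^ 2

    f : Carrier → Carrier → Carrier → Carrier
    f a b x = (pow R x (2 ℕ.* q ℕ.^ 2) + a * pow R x (q ℕ.^ 2 ℕ.+ q ℕ.∸ 1)) + b * pow R x (q ℕ.^ 2 ℕ.∸ q ℕ.+ 1)

    Nm*f : ∀ a b x → Nm x * f a b x ≈ (φ (φ x) * φ (φ x)) * ((Nm x + a * (φ x * φ x)) + b * (x * x))
    Nm*f a b x = begin
      N * ((pow R x (2 ℕ.* q ℕ.^ 2) + a * A) + b * B)                           ≈⟨ *-congˡ (+-congʳ (+-congʳ (pow-[2q²] x))) ⟩
      N * ((x₂ * x₂ + a * A) + b * B)                                             ≈⟨ solve 7 (λ x x₁ x₂ a b A B →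
                                                                                     ((x :* x₁) :* x₂) :* ((x₂ :* x₂ :+ a :* A) :+ b :* B)
                                                                                     := ((x₂ :* x₂) :* ((x :* x₁) :* x₂) :+ (a :* (x₁ :* x₂)) :* (x :* A))
                                                                                        :+ (b :* (x :* x₂)) :* (x₁ :* B)) refl x x₁ x₂ a b A B ⟩
      ((x₂ * x₂) * N + (a * (x₁ * x₂)) * (x * A)) + (b * (x * x₂)) * (x₁ * B)   ≈⟨ +-cong (+-congˡ (*-congˡ (x*pow-[q²+q∸1] x))) (*-congˡ (φx*pow-[q²∸q+1] x)) ⟩
      ((x₂ * x₂) * N + (a * (x₁ * x₂)) * (x₂ * x₁)) + (b * (x * x₂)) * (x₂ * x)  ≈⟨ solve 5 (λ x x₁ x₂ a b →
                                                                                     ((x₂ :* x₂) :* ((x :* x₁) :* x₂) :+ (a :* (x₁ :* x₂)) :* (x₂ :* x₁)) :+ (b :* (x :* x₂)) :* (x₂ :* x)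
                                                                                     := (x₂ :* x₂) :* ((((x :* x₁) :* x₂) :+ a :* (x₁ :* x₁)) :+ b :* (x :* x))) refl x x₁ x₂ a b ⟩
      (x₂ * x₂) * ((N + a * (x₁ * x₁)) + b * (x * x))                            ∎
      where
      x₁ = φ x; x₂ = φ x₁; N = Nm x
      A = pow R x (q ℕ.^ 2 ℕ.+ q ℕ.∸ 1)
      B = pow R x (q ℕ.^ 2 ℕ.∸ q ℕ.+ 1)

    f-zero : ∀ {a b x} → x ≈ 0# → f a b x ≈ 0#
    f-zero {a} {b} {x} x≈0 = begin
      f a b x                          ≈⟨ +-cong (+-cong (pow-zero 1≤2q²) (*-congˡ (pow-zero 1≤q²+q∸1))) (*-congˡ (pow-zero 1≤q²∸q+1)) ⟩
      (0# + a * 0#) + b * 0#           ≈⟨ solve 2 (λ a b → (con false :+ a :* con false) :+ b :* con false := con false) refl a b ⟩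
      0#                               ∎
      where
      pow-zero : ∀ {k} → 1 ℕ.≤ k → pow R x k ≈ 0#
      pow-zero {ℕ.suc k} _ = trans (*-congʳ x≈0) (zeroˡ (pow R x k))
      1≤q² = ℕ.≤-trans 1≤q (q≤q² q)
      1≤2q² = ℕ.≤-trans 1≤q² (ℕ.m≤m+n (q ℕ.^ 2) _)
      1≤q²+q∸1 = ℕ.≤-trans 1≤q² (ℕ.≤-trans (ℕ.m≤m+n (q ℕ.^ 2) (q ℕ.∸ 1)) (ℕ.≤-reflexive (≡.sym (ℕ.+-∸-assoc (q ℕ.^ 2) 1≤q))))
      1≤q²∸q+1 = ℕ.m≤n+m 1 (q ℕ.^ 2 ℕ.∸ q)

    f-root : ∀ {a b} → Fixed a → Fixed b → f a b (a + b) ≈ 0#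
    f-root {a} {b} a-Fixed b-Fixed with a + b ≟ 0#
    ... | yes a+b≈0 = f-zero a+b≈0
    ... | no  a+b≉0 = *-cancelˡ-nonzero (Nm-nonzero a+b≉0) (begin
      Nm t * f a b t                                          ≈⟨ Nm*f a b t ⟩
      (t₂ * t₂) * ((Nm t + a * (t₁ * t₁)) + b * (t * t))      ≈⟨ *-cong (*-cong t₂≈t t₂≈t) (+-congʳ (+-cong (e₃-cong refl t-Fixed t₂≈t) (*-congˡ (*-cong t-Fixed t-Fixed)))) ⟩
      (t * t) * (((t * t) * t + a * (t * t)) + b * (t * t))   ≈⟨ solve 2 (λ a b → let t = a :+ b in
                                                                   (t :* t) :* (((t :* t) :* t :+ a :* (t :* t)) :+ b :* (t :* t)) := con false) refl a b ⟩
      0#                                                      ≈⟨ zeroʳ (Nm t) ⟨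
      Nm t * 0#                                               ∎)
      where
      t = a + b; t₁ = φ t; t₂ = φ t₁
      t-Fixed : Fixed t
      t-Fixed = Fixed-+ a-Fixed b-Fixed
      t₂≈t : t₂ ≈ t
      t₂≈t = trans (φ-cong t-Fixed) t-Fixed

    InSubfield⇒Fixed : ∀ {a} → InSubfield R q a → Fixed a
    InSubfield⇒Fixed {a} a^q≈a = trans (reflexive (≡.sym (pow≡^ a q))) a^q≈a

    permutation⇒b≈a : ∀ {a b} → Fixed a → Fixed b → IsPermutation R (f a b) → b ≈ a
    permutation⇒b≈a {a} {b} a-Fixed b-Fixed (f-injective , _) =
      sym (x+y≈0⇒x≈y (f-injective (a + b) 0# (trans (f-root a-Fixed b-Fixed) (sym (f-zero refl)))))

    b≈a⇒permutation : ∀ {a b} → Fixed a → a ≉ 0# → b ≈ a → IsPermutation R (f a b)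
    b≈a⇒permutation {a} {b} a-Fixed a≉0 b≈a = injective , injective⇒surjective (f a b) injective
      where
      open PermutationPolynomial a a-Fixed a≉0 (f a a) (Nm*f a a) f-zero using (f-injective)

      fab≈faa : ∀ x → f a b x ≈ f a a x
      fab≈faa x = +-congˡ (*-congʳ b≈a)

      injective : ∀ x y → f a b x ≈ f a b y → x ≈ y
      injective x y fx≈fy = f-injective x y (trans (sym (fab≈faa x)) (trans fx≈fy (fab≈faa y)))

open import Data.Nat using (ℕ; _≤_; _+_; _*_; _∸_; _^_)

theorem3p1 : (m : ℕ) → 1 ≤ m →
    (R : CommutativeRing 0ℓ 0ℓ) → IsField R → HasCard R ((2 ^ m) ^ 3) →
    let module F = CommutativeRing R
        q = 2 ^ m
    in (a b : F.Carrier) →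
       InSubfield R q a → ¬ (a F.≈ F.0#) →
       InSubfield R q b → ¬ (b F.≈ F.0#) →
       IsPermutation R (λ x → (pow R x (2 * q ^ 2) F.+ a F.* pow R x (q ^ 2 + q ∸ 1)) F.+ b F.* pow R x (q ^ 2 ∸ q + 1))
       ⇔ (b F.≈ a)
theorem3p1 m 1≤m R isField card a b a∈𝔽q a≉0 b∈𝔽q _ =
  mk⇔ (permutation⇒b≈a (InSubfield⇒Fixed a∈𝔽q) (InSubfield⇒Fixed b∈𝔽q))
      (b≈a⇒permutation (InSubfield⇒Fixed a∈𝔽q) a≉0)
  where open CubicExtensionOfF₂ᵐ R isField m 1≤m card
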